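{- Let $G$ be a trapezoid graph, $R$ a trapezoid representation of $G$, and $u$ a vertex of $G$ with $\delta^*_u\neq\emptyset$ (for any admissible choice of $\delta_u,\delta^*_u$). Let $V_i$ be the master component of $u$ with $\delta_u=V_i$. If $R(V_i)\ll_R T_u$, then $N_X(u)=N_X(u,R)$ for every $X\in\{0,1,2,12\}$.
   Context: A trapezoid representation $R$ of $G$ assigns to each vertex $x$ a trapezoid $T_x$ between two horizontal parallel lines $L_1,L_2$ (two vertices on each line, all endpoints distinct), with $xy\in E$ iff $T_x\cap T_y\neq\emptyset$; $R(S)\ll_R T_u$ means all trapezoids of vertices of $S$ lie completely to the left of $T_u$. $N(x)$ is the neighborhood, $N[x]=N(x)\cup\{x\}$, $N(W)=\bigcup_{w\in W}N(w)\setminus W$. Let $V_1,\ldots,V_\omega$ be the vertex sets of the components of $G\setminus N[u]$; $D_u(V_i)=\{V_p: N(V_p)\subseteq N(V_i)\}$; $D^*_u(V_i)=\{V_1,\ldots,V_\omega\}\setminus D_u(V_i)$; $V_i$ is a master component if $|D_u(V_i)|\ge |D_u(V_j)|$ for all $j$; a component $V_j$ of a set $S$ of components is maximal in $S$ if no $V_l\in S$ has $N(V_j)\subsetneq N(V_l)$. $\delta_u$ is an arbitrarily chosen master component $V_i$ of $u$; $\delta^*_u=\emptyset$ if $D^*_u(V_i)=\emptyset$, otherwise $\delta^*_u$ is an arbitrarily chosen maximal component of $D^*_u(V_i)$. Graph partition of $N(u)$: $N_0(u)$ = neighbors adjacent to no vertex of $\delta_u$ nor of $\delta^*_u$; $N_1(u)$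 = adjacent to $\delta_u$ but not $\delta^*_u$; $N_2(u)$ = adjacent to $\delta^*_u$ but not $\delta_u$; $N_{12}(u)$ = adjacent to both. Representation partition: let $D_1(u,R)$ and $D_2(u,R)$ be the sets of vertices whose trapezoids lie completely to the left, respectively right, of $T_u$; $N_0(u,R)$, $N_1(u,R)$, $N_2(u,R)$, $N_{12}(u,R)$ are defined in the same way with $D_1(u,R)$ in place of $\delta_u$ and $D_2(u,R)$ in place of $\delta^*_u$. -}

module Defs where

open import Data.Nat using (ℕ; _<_; _≤_)
open import Data.Fin using (Fin)
open import Data.Fin.Subset using (Subset; _∈_; _∉_; _⊆_; _⊂_; Nonempty; inside; outside)
open import Data.Fin.Subset.Properties using (_⊆?_)
open import Data.Bool using (Bool; true; false; not; _∧_)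
open import Data.Vec using (tabulate; lookup)
open import Data.List using (List; length; filter; allFin)
open import Data.Bool.ListAction using (any)
open import Data.Product using (_×_; Σ; ∃; ∃-syntax; _,_)
open import Relation.Binary.PropositionalEquality using (_≡_; _≢_)
open import Relation.Nullary using (¬_)
open import Function.Bundles using (_⇔_)

record Graph (n : ℕ) : Set where
  field
    adj     : Fin n → Fin n → Bool
    sym     : ∀ x y → adj x y ≡ adj y x
    irrefl  : ∀ x → adj x x ≡ false
open Graph public

module _ {n : ℕ} (G : Graph n) where

  Adj : Fin n → Fin n → Set
  Adj x y = adj G x y ≡ true

  Nb : Subset n → Subset n
  Nb W = tabulate λ v → not (lookup W v) ∧ any (λ w → lookup W w ∧ adj G w v) (allFin n)

  OutsideClosedNb : Fin n → Fin n → Set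
  OutsideClosedNb u x = (x ≢ u) × ¬ Adj u x

  data Reach (C : Subset n) : Fin n → Fin n → Set where
    here : ∀ {x} → Reach C x x
    step : ∀ {x y z} → Adj x y → y ∈ C → Reach C y z → Reach C x z

  record IsComponent (u : Fin n) (C : Subset n) : Set where
    field
      nonempty  : Nonempty C
      avoids    : ∀ x → x ∈ C → OutsideClosedNb u x
      connected : ∀ x y → x ∈ C → y ∈ C → Reach C x y
      closed    : ∀ x y → x ∈ C → OutsideClosedNb u y → Adj x y → y ∈ C

  record Components (u : Fin n) (ω : ℕ) (V : Fin ω → Subset n) : Set where
    field
      isComp   : ∀ k → IsComponent u (V k)
      injective : ∀ k l → V k ≡ V l → k ≡ l
      complete : ∀ C → IsComponent u C → ∃[ k ] V k ≡ C

  module _ {ω : ℕ} (V : Fin ω → Subset n) where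

    InD : Fin ω → Fin ω → Set
    InD i p = Nb (V p) ⊆ Nb (V i)

    cardD : Fin ω → ℕ
    cardD i = length (filter (λ p → Nb (V p) ⊆? Nb (V i)) (allFin ω))

    InDstar : Fin ω → Fin ω → Set
    InDstar i p = ¬ InD i p

    Master : Fin ω → Set
    Master i = ∀ j → cardD j ≤ cardD i

    MaximalInDstar : Fin ω → Fin ω → Set
    MaximalInDstar i j = InDstar i j × (∀ l → InDstar i l → ¬ (Nb (V j) ⊂ Nb (V l)))

  AdjToSet : Subset n → Fin n → Set
  AdjToSet A x = ∃[ w ] (w ∈ A × Adj x w)

  AdjToPred : (Fin n → Set) → Fin n → Set
  AdjToPred A x = ∃[ w ] (A w × Adj x w)

data Part : Set where
  p0 p1 p2 p12 : Part

-- Membership in N_X(u) relative to two vertex sets given as predicates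
-- (A plays the role of δ_u / D_1(u,R), B of δ*_u / D_2(u,R)).
NX : ∀ {n} → Graph n → Part → Fin n → (Fin n → Set) → (Fin n → Set) → Fin n → Set
NX G p0  u A B x = Adj G u x × ¬ AdjToPred G A x × ¬ AdjToPred G B x
NX G p1  u A B x = Adj G u x × AdjToPred G A x × ¬ AdjToPred G B x
NX G p2  u A B x = Adj G u x × ¬ AdjToPred G A x × AdjToPred G B x
NX G p12 u A B x = Adj G u x × AdjToPred G A x × AdjToPred G B x

-- Only the order of endpoints on each line matters, so positions are ℕ.

record Trapezoid : Set where
  field
    top₁ top₂ bot₁ bot₂ : ℕ
    top< : top₁ < top₂
    bot< : bot₁ < bot₂
open Trapezoid public

_≪_ : Trapezoid → Trapezoid → Set
T ≪ S = (top₂ T < top₁ S) × (bot₂ T < bot₁ S)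

-- T ∩ S ≠ ∅ (for trapezoids with pairwise distinct endpoints on each line
-- this holds iff neither lies completely to the left of the other)
Intersect : Trapezoid → Trapezoid → Set
Intersect T S = ¬ (T ≪ S) × ¬ (S ≪ T)

DistinctEndpoints : ∀ {n} → (Fin n → Trapezoid) → Set
DistinctEndpoints {n} R =
  (∀ x y → top₁ (R x) ≡ top₁ (R y) → x ≡ y) ×
  (∀ x y → top₂ (R x) ≡ top₂ (R y) → x ≡ y) ×
  (∀ x y → top₁ (R x) ≢ top₂ (R y)) ×
  (∀ x y → bot₁ (R x) ≡ bot₁ (R y) → x ≡ y) ×
  (∀ x y → bot₂ (R x) ≡ bot₂ (R y) → x ≡ y) ×
  (∀ x y → bot₁ (R x) ≢ bot₂ (R y))

record IsTrapezoidRep {n} (G : Graph n) (R : Fin n → Trapezoid) : Set where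
  field
    distinct : DistinctEndpoints R
    represents : ∀ x y → x ≢ y → (Adj G x y ⇔ Intersect (R x) (R y))

D₁ : ∀ {n} → (Fin n → Trapezoid) → Fin n → Fin n → Set
D₁ R u x = R x ≪ R u

D₂ : ∀ {n} → (Fin n → Trapezoid) → Fin n → Fin n → Set
D₂ R u x = R u ≪ R x

module Submission where

-- Both partitions follow the same recipe (NX-cong), so it suffices that a
-- neighbour x of u meets V_i iff it meets a trapezoid left of T_u, and meets
-- δ*_u = V_j iff it meets a trapezoid right of T_u.  The forward directions
-- hold as V_i is left of T_u (hypothesis) and V_j is right of it (Vj-right).
-- Backwards, let x meet w ∈ V_k.  The widening lemma: if a component C lies
-- on w's side of T_u and x misses C, then N(C) ⊊ N(V_k); it rests on the fact
-- that a trapezoid meeting two others meets every trapezoid between them.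
-- For C = V_i this contradicts |D_u(V_i)| being maximal, for C = V_j the
-- maximality of V_j in D*_u(V_i).

open import Defs
open import Data.Nat using (ℕ; _<_; _≤_; s≤s; z≤n)
open import Data.Nat.Properties using (<-trans; <-asym; _<?_; <⇒≱; m≤n⇒m≤1+n)
open import Data.Fin using (Fin; _≟_)
open import Data.Fin.Subset using (Subset; _∈_; _∉_; _⊆_; _⊂_; _⊃_; _∪_; _∩_; ⁅_⁆)
open import Data.Fin.Subset.Properties
  using (_∈?_; _⊆?_; _⊂?_; x∈⁅x⁆; x∈⁅y⁆⇒x≡y; p⊆p∪q; x∈p∪q⁻; x∈p∪q⁺; x∈p∩q⁻; x∈p∩q⁺)
open import Data.Fin.Subset.Induction using (Acc; acc; ⊃-wellFounded)
open import Data.Fin.Properties using (any?)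
open import Data.Bool using (Bool; true; false; not; _∧_; T) renaming (_≟_ to _≟ᵇ_)
open import Data.Bool.Properties using (T-≡; T-∧)
open import Data.Bool.ListAction using (any)
open import Data.Vec using (tabulate; lookup)
open import Data.Vec.Properties using ([]=⇒lookup; lookup⇒[]=; lookup∘tabulate)
open import Data.List using ([]; _∷_; length; filter; allFin)
open import Data.List.Relation.Unary.Any using (here; there; satisfied)
open import Data.List.Relation.Unary.Any.Properties using (any⁺; any⁻)
open import Data.List.Membership.Propositional using (lose) renaming (_∈_ to _∈ˡ_)
open import Data.List.Membership.Propositional.Properties using (∈-allFin)
open import Data.Product using (_×_; Σ; ∃; _,_; proj₁; proj₂)
open import Data.Sum using (_⊎_; inj₁; inj₂)
open import Data.Empty using (⊥-elim)
open import Function using (_∘_)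
open import Function.Bundles using (_⇔_; mk⇔; Equivalence)
import Function.Properties.Equivalence as ⇔
open import Relation.Binary.PropositionalEquality using (_≡_; _≢_; refl; trans; subst) renaming (sym to ≡-sym)
open import Relation.Nullary using (¬_; Dec; yes; no; contradiction)
open import Relation.Nullary.Decidable using (_×-dec_; ¬?; isYes; toWitness; fromWitness; decidable-stable)
open import Relation.Unary using (Decidable)

open Equivalence using (to; from)

T-not : ∀ {b} → T (not b) ⇔ (¬ T b)
T-not {false} = mk⇔ (λ _ ()) (λ _ → _)
T-not {true}  = mk⇔ (λ ()) (λ ¬t → ¬t _)

∈⇔T : ∀ {n} {p : Subset n} {x : Fin n} → x ∈ p ⇔ T (lookup p x)
∈⇔T {p = p} {x} = mk⇔ (from T-≡ ∘ []=⇒lookup) (lookup⇒[]= x p ∘ to T-≡)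

∈-tabulate : ∀ {n} {f : Fin n → Bool} {x : Fin n} → x ∈ tabulate f ⇔ T (f x)
∈-tabulate {f = f} {x} = mk⇔
  (subst T (lookup∘tabulate f x) ∘ to ∈⇔T)
  (from ∈⇔T ∘ subst T (≡-sym (lookup∘tabulate f x)))

any-allFin : ∀ {n} (f : Fin n → Bool) → T (any f (allFin n)) ⇔ ∃ (T ∘ f)
any-allFin {n} f = mk⇔
  (satisfied ∘ any⁻ f (allFin n))
  (λ (w , t) → any⁺ f (lose (∈-allFin w) t))

module _ {n} (G : Graph n) {W : Subset n} {y : Fin n} where

  ∈Nb⁻ : y ∈ Nb G W → y ∉ W × ∃ λ w → w ∈ W × Adj G w y
  ∈Nb⁻ m with to T-∧ (to ∈-tabulate m)
  ... | y∉W , t with to (any-allFin _) t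
  ...   | w , t′ with to T-∧ t′
  ...     | w∈W , wy = to T-not y∉W ∘ to ∈⇔T , w , from ∈⇔T w∈W , to T-≡ wy

  ∈Nb⁺ : ∀ {w} → y ∉ W → w ∈ W → Adj G w y → y ∈ Nb G W
  ∈Nb⁺ {w} y∉W w∈W wy = from ∈-tabulate (from T-∧
    ( from T-not (y∉W ∘ from ∈⇔T)
    , from (any-allFin _) (w , from T-∧ (to ∈⇔T w∈W , from T-≡ wy))))

module _ {A : Set} {P Q : A → Set} (P? : Decidable P) (Q? : Decidable Q)
         (P⇒Q : ∀ {a} → P a → Q a) where

  filter-mono-≤ : ∀ xs → length (filter P? xs) ≤ length (filter Q? xs)
  filter-mono-≤ []       = z≤n
  filter-mono-≤ (x ∷ xs) with P? x | Q? x
  ... | yes _ | yes _ = s≤s (filter-mono-≤ xs)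
  ... | yes p | no ¬q = contradiction (P⇒Q p) ¬q
  ... | no _  | yes _ = m≤n⇒m≤1+n (filter-mono-≤ xs)
  ... | no _  | no _  = filter-mono-≤ xs

  filter-mono-< : ∀ {k} xs → k ∈ˡ xs → Q k → ¬ P k →
                  length (filter P? xs) < length (filter Q? xs)
  filter-mono-< (x ∷ xs) (here refl) qk ¬pk with P? x | Q? x
  ... | yes pk | _     = contradiction pk ¬pk
  ... | no _   | yes _ = s≤s (filter-mono-≤ xs)
  ... | no _   | no ¬q = contradiction qk ¬q
  filter-mono-< (x ∷ xs) (there k∈xs) qk ¬pk with P? x | Q? x
  ... | yes _ | yes _ = s≤s (filter-mono-< xs k∈xs qk ¬pk)
  ... | yes p | no ¬q = contradiction (P⇒Q p) ¬q
  ... | no _  | yes _ = m≤n⇒m≤1+n (filter-mono-< xs k∈xs qk ¬pk)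
  ... | no _  | no _  = filter-mono-< xs k∈xs qk ¬pk

cardD-strict : ∀ {n ω} (G : Graph n) (V : Fin ω → Subset n) {i k : Fin ω} →
               Nb G (V i) ⊂ Nb G (V k) → cardD G V i < cardD G V k
cardD-strict G V {i} {k} (i⊆k , y , y∈k , y∉i) =
  filter-mono-< (λ p → Nb G (V p) ⊆? Nb G (V i)) (λ p → Nb G (V p) ⊆? Nb G (V k))
    (λ p⊆i → i⊆k ∘ p⊆i) (allFin _) (∈-allFin k) (λ y∈k → y∈k) (λ k⊆i → y∉i (k⊆i y∈k))

≪-trans : ∀ {A} B {C} → A ≪ B → B ≪ C → A ≪ C
≪-trans B (t₁ , b₁) (t₂ , b₂) = <-trans t₁ (<-trans (top< B) t₂) , <-trans b₁ (<-trans (bot< B) b₂)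

≪-irrefl : ∀ A → ¬ (A ≪ A)
≪-irrefl A (t , _) = <-asym (top< A) t

≪? : ∀ A B → Dec (A ≪ B)
≪? A B = (top₂ A <? top₁ B) ×-dec (bot₂ A <? bot₁ B)

Between : Trapezoid → Trapezoid → Trapezoid → Set
Between A B C = (A ≪ B × B ≪ C) ⊎ (C ≪ B × B ≪ A)

intersect-between : ∀ {X A B C} → Intersect X A → Intersect X C → Between A B C → Intersect X B
intersect-between {X} {A} {B} {C} (_ , A≮X) (X≮C , _) (inj₁ (A≪B , B≪C)) =
  (λ X≪B → X≮C (≪-trans {X} B {C} X≪B B≪C)) , (λ B≪X → A≮X (≪-trans {A} B {X} A≪B B≪X))
intersect-between {X} {A} {B} {C} (X≮A , _) (_ , C≮X) (inj₂ (C≪B , B≪A)) =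
  (λ X≪B → X≮A (≪-trans {X} B {A} X≪B B≪A)) , (λ B≪X → C≮X (≪-trans {C} B {X} C≪B B≪X))

module Components-of {n} (G : Graph n) (u : Fin n) where

  open IsComponent

  Outside : Fin n → Set
  Outside = OutsideClosedNb G u

  adj-sym : ∀ {x y} → Adj G x y → Adj G y x
  adj-sym {x} {y} xy = trans (≡-sym (Graph.sym G x y)) xy

  adj⇒≢ : ∀ {x y} → Adj G x y → x ≢ y
  adj⇒≢ {x} xy refl with () ← trans (≡-sym xy) (irrefl G x)

  neighbour≢outside : ∀ {x w} → Adj G u x → Outside w → x ≢ w
  neighbour≢outside ux (_ , ¬uw) refl = ¬uw ux

  boundary⊆N[u] : ∀ {C y v} → IsComponent G u C → y ∉ C → v ∈ C → Adj G v y → Adj G u y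
  boundary⊆N[u] {C} {y} {v} c y∉C v∈C vy with y ≟ u | adj G u y in uy
  ... | yes refl | _     = contradiction (adj-sym vy) (proj₂ (avoids c v v∈C))
  ... | no _     | true  = refl
  ... | no y≢u   | false = contradiction (closed c v y v∈C (y≢u , λ uy′ → contradiction (trans (≡-sym uy′) uy) λ ()) vy) y∉C

  component-⊆ : ∀ {C C′ z} → IsComponent G u C → IsComponent G u C′ → z ∈ C → z ∈ C′ → C ⊆ C′
  component-⊆ {C} {C′} {z} c c′ z∈C z∈C′ {y} y∈C = along (connected c z y z∈C y∈C) z∈C′
    where
    along : ∀ {a b} → Reach G C a b → a ∈ C′ → b ∈ C′
    along here a∈C′ = a∈C′
    along {a} (step ab b∈C path) a∈C′ = along path (closed c′ a _ a∈C′ (avoids c _ b∈C) ab)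

  reach-mono : ∀ {C C′ a b} → C ⊆ C′ → Reach G C a b → Reach G C′ a b
  reach-mono C⊆C′ here              = here
  reach-mono C⊆C′ (step ab b∈C path) = step ab (C⊆C′ b∈C) (reach-mono C⊆C′ path)

  reach-snoc : ∀ {C a b c} → Reach G C a b → Adj G b c → c ∈ C → Reach G C a c
  reach-snoc here               bc c∈C = step bc c∈C here
  reach-snoc (step ab b∈C path) bc c∈C = step ab b∈C (reach-snoc path bc c∈C)

  reach-++ : ∀ {C a b c} → Reach G C a b → Reach G C b c → Reach G C a c
  reach-++ here               q = q
  reach-++ (step ab b∈C path) q = step ab b∈C (reach-++ path q)

  reach-reverse : ∀ {C a b} → a ∈ C → Reach G C a b → Reach G C b a
  reach-reverse a∈C path = go a∈C path here
    where
    go : ∀ {C a b c} → a ∈ C → Reach G C a b → Reach G C a c → Reach G C b c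
    go a∈C here               sofar = sofar
    go a∈C (step ab b∈C path) sofar = go b∈C path (step (adj-sym ab) a∈C sofar)

  -- The component through a vertex w of G \ N[u] is obtained by repeatedly
  -- adding the neighbours outside N[u] of the current set; growth stops
  -- because strict inclusion of subsets of Fin n is well founded.
  outside? : Decidable Outside
  outside? y = ¬? (y ≟ u) ×-dec ¬? (adj G u y ≟ᵇ true)

  outsideSet : Subset n
  outsideSet = tabulate λ y → isYes (outside? y)

  grow : Subset n → Subset n
  grow S = S ∪ (outsideSet ∩ Nb G S)

  module _ (w : Fin n) where

    Grown : Subset n → Set
    Grown S = w ∈ S × (∀ y → y ∈ S → Outside y × Reach G S w y)

    grow-preserves : ∀ {S} → Grown S → Grown (grow S)
    grow-preserves {S} (w∈S , reach) = p⊆p∪q _ w∈S , extend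
      where
      extend : ∀ y → y ∈ grow S → Outside y × Reach G (grow S) w y
      extend y m with x∈p∪q⁻ S _ m
      ... | inj₁ y∈S = proj₁ (reach y y∈S) , reach-mono (p⊆p∪q _) (proj₂ (reach y y∈S))
      ... | inj₂ m′ with x∈p∩q⁻ outsideSet _ m′
      ...   | y∈out , y∈N with ∈Nb⁻ G y∈N
      ...     | _ , z , z∈S , zy =
        toWitness (to ∈-tabulate y∈out) ,
        reach-snoc (reach-mono (p⊆p∪q _) (proj₂ (reach z z∈S))) zy m

    grown-fixpoint : ∀ {S} → Grown S → grow S ⊆ S → IsComponent G u S
    grown-fixpoint {S} (w∈S , reach) stable = record
      { nonempty  = w , w∈S
      ; avoids    = λ x x∈S → proj₁ (reach x x∈S)
      ; connected = λ x y x∈S y∈S →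
          reach-++ (reach-reverse w∈S (proj₂ (reach x x∈S))) (proj₂ (reach y y∈S))
      ; closed    = closure
      }
      where
      closure : ∀ x y → x ∈ S → Outside y → Adj G x y → y ∈ S
      closure x y x∈S y-out xy with y ∈? S
      ... | yes y∈S = y∈S
      ... | no  y∉S = stable (x∈p∪q⁺ (inj₂ (x∈p∩q⁺
              (from ∈-tabulate (fromWitness y-out) , ∈Nb⁺ G y∉S x∈S xy))))

    grow-until-stable : ∀ S → Acc _⊃_ S → Grown S → Σ (Subset n) λ C → w ∈ C × IsComponent G u C
    grow-until-stable S (acc rec) grown with S ⊂? grow S
    ... | yes S⊂S′ = grow-until-stable (grow S) (rec S⊂S′) (grow-preserves grown)
    ... | no  S⊄S′ = S , proj₁ grown , grown-fixpoint grown stable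
      where
      stable : grow S ⊆ S
      stable {x} x∈S′ with x ∈? S
      ... | yes x∈S = x∈S
      ... | no  x∉S = contradiction ((λ {_} → p⊆p∪q _) , x , x∈S′ , x∉S) S⊄S′

    componentOf : Outside w → Σ (Subset n) λ C → w ∈ C × IsComponent G u C
    componentOf w-out = grow-until-stable ⁅ w ⁆ (⊃-wellFounded _)
      (x∈⁅x⁆ w , λ y y∈w → subst (λ v → Outside v × Reach G ⁅ w ⁆ w v)
                                  (≡-sym (x∈⁅y⁆⇒x≡y w y∈w)) (w-out , here))

module Representation {n} (G : Graph n) (R : Fin n → Trapezoid) (rep : IsTrapezoidRep G R)
                      (u : Fin n) where

  open IsTrapezoidRep rep
  open IsComponent
  open Components-of G u

  adj⇒intersect : ∀ {x y} → Adj G x y → Intersect (R x) (R y)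
  adj⇒intersect {x} {y} xy = to (represents x y (adj⇒≢ xy)) xy

  intersect⇒adj : ∀ {x y} → x ≢ y → Intersect (R x) (R y) → Adj G x y
  intersect⇒adj {x} {y} x≢y = from (represents x y x≢y)

  nonadjacent⇒ordered : ∀ {x y} → x ≢ y → ¬ Adj G x y → R x ≪ R y ⊎ R y ≪ R x
  nonadjacent⇒ordered {x} {y} x≢y ¬xy with ≪? (R x) (R y) | ≪? (R y) (R x)
  ... | yes x≪y | _       = inj₁ x≪y
  ... | no _    | yes y≪x = inj₂ y≪x
  ... | no x≮y  | no y≮x  = contradiction (intersect⇒adj x≢y (x≮y , y≮x)) ¬xy

  data Side : Set where
    left right : Side

  OnSide : Side → Fin n → Set
  OnSide left  w = R w ≪ R u
  OnSide right w = R u ≪ R w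

  onSide⇒outside : ∀ s {w} → OnSide s w → Outside w
  onSide⇒outside left  w≪u = (λ { refl → ≪-irrefl (R u) w≪u }) , λ uw → proj₂ (adj⇒intersect uw) w≪u
  onSide⇒outside right u≪w = (λ { refl → ≪-irrefl (R u) u≪w }) , λ uw → proj₁ (adj⇒intersect uw) u≪w

  outside⇒onSide : ∀ {w} → Outside w → OnSide left w ⊎ OnSide right w
  outside⇒onSide (w≢u , ¬uw) = nonadjacent⇒ordered w≢u (¬uw ∘ adj-sym)

  component-left : ∀ {C z y} → IsComponent G u C → z ∈ C → OnSide left z → y ∈ C → OnSide left y
  component-left {C} {z} {y} c z∈C z≪u y∈C = along (connected c z y z∈C y∈C) z≪u
    where
    along : ∀ {a b} → Reach G C a b → R a ≪ R u → R b ≪ R u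
    along here a≪u = a≪u
    along {a} (step {y = b} ab b∈C path) a≪u with outside⇒onSide (avoids c b b∈C)
    ... | inj₁ b≪u = along path b≪u
    ... | inj₂ u≪b = contradiction (≪-trans {R a} (R u) {R b} a≪u u≪b) (proj₁ (adj⇒intersect ab))

  same-side-between : ∀ s {a b} → OnSide s a → OnSide s b → a ≢ b → ¬ Adj G a b →
                      Between (R a) (R b) (R u) ⊎ Between (R b) (R a) (R u)
  same-side-between s a-s b-s a≢b ¬ab with s | nonadjacent⇒ordered a≢b ¬ab
  ... | left  | inj₁ a≪b = inj₁ (inj₁ (a≪b , b-s))
  ... | left  | inj₂ b≪a = inj₂ (inj₁ (b≪a , a-s))
  ... | right | inj₁ a≪b = inj₂ (inj₂ (a-s , a≪b))
  ... | right | inj₂ b≪a = inj₁ (inj₂ (b-s , b≪a))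

  adjacent-between : ∀ s {x a b} → Adj G u x → Adj G x a → OnSide s b →
                     Between (R a) (R b) (R u) → Adj G x b
  adjacent-between s {x} {a} {b} ux xa b-s between =
    intersect⇒adj (neighbour≢outside ux (onSide⇒outside s b-s))
      (intersect-between {R x} {R a} {R b} {R u}
        (adj⇒intersect {x} {a} xa) (adj⇒intersect {x} {u} (adj-sym ux)) between)

  widen : ∀ s {C K x w} → IsComponent G u C → IsComponent G u K →
          (∀ v → v ∈ C → OnSide s v) → w ∈ K → OnSide s w →
          Adj G u x → Adj G x w → ¬ AdjToPred G (_∈ C) x → Nb G C ⊂ Nb G K
  widen s {C} {K} {x} {w} c k C-s w∈K w-s ux xw x-misses-C =
    N[C]⊆N[K] , x , ∈Nb⁺ G x∉K w∈K (adj-sym xw) , x∉N[C]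
    where
    x∉K : x ∉ K
    x∉K x∈K = proj₂ (avoids k x x∈K) ux
    x∉N[C] : x ∉ Nb G C
    x∉N[C] x∈N with ∈Nb⁻ G x∈N
    ... | _ , v , v∈C , vx = x-misses-C (v , v∈C , adj-sym vx)
    N[C]⊆N[K] : Nb G C ⊆ Nb G K
    N[C]⊆N[K] {y} y∈N with ∈Nb⁻ G y∈N
    ... | y∉C , v , v∈C , vy with v ∈? K
    ...   | yes v∈K = contradiction (w , component-⊆ k c v∈K v∈C w∈K , xw) x-misses-C
    ...   | no  v∉K with same-side-between s w-s (C-s v v∈C) (λ { refl → v∉K w∈K })
                           (λ wv → v∉K (closed k w v w∈K (avoids c v v∈C) wv))
    ...     | inj₁ v-between = contradiction (v , v∈C , adjacent-between s ux xw (C-s v v∈C) v-between)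
                                             x-misses-C
    ...     | inj₂ w-between = ∈Nb⁺ G (λ y∈K → proj₂ (avoids k y y∈K) uy) w∈K
                                  (adj-sym (adjacent-between s uy (adj-sym vy) w-s w-between))
      where
      uy : Adj G u y
      uy = boundary⊆N[u] c y∉C v∈C vy

module Lemma-2-10 {n} (G : Graph n) (R : Fin n → Trapezoid) (rep : IsTrapezoidRep G R)
                  (u : Fin n) (ω : ℕ) (V : Fin ω → Subset n) (comps : Components G u ω V)
                  (i j : Fin ω) (master : Master G V i) (maximal : MaximalInDstar G V i j)
                  (Vi-left : ∀ x → x ∈ V i → R x ≪ R u) where

  open Components comps
  open IsComponent
  open Components-of G u
  open Representation G R rep u

  indexOf : ∀ {w} → Outside w → ∃ λ k → w ∈ V k
  indexOf {w} w-out with componentOf w w-out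
  ... | C , w∈C , c with complete C c
  ...   | k , refl = k , w∈C

  -- Whether x meets the vertex set A is decidable, so the indirect proofs
  -- below are constructive.
  meets? : (A : Subset n) → Decidable (AdjToPred G (_∈ A))
  meets? A x = any? λ w → (w ∈? A) ×-dec (adj G x w ≟ᵇ true)

  -- A neighbour of u meeting a trapezoid left of T_u meets V_i: otherwise
  -- widening V_i would beat the master component.
  left⇒meets-δ : ∀ {x w} → Adj G u x → Adj G x w → R w ≪ R u → AdjToPred G (_∈ V i) x
  left⇒meets-δ {x} ux xw w≪u = decidable-stable (meets? (V i) x) λ misses →
    let k , w∈Vk = indexOf (onSide⇒outside left w≪u)
    in <⇒≱ (cardD-strict G V (widen left (isComp i) (isComp k) Vi-left w∈Vk w≪u ux xw misses))
           (master k)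

  left-component-Nb⊆ : ∀ {C} → IsComponent G u C → (∀ v → v ∈ C → R v ≪ R u) → Nb G C ⊆ Nb G (V i)
  left-component-Nb⊆ c C-left y∈N with ∈Nb⁻ G y∈N
  ... | y∉C , v , v∈C , vy with left⇒meets-δ (boundary⊆N[u] c y∉C v∈C vy) (adj-sym vy) (C-left v v∈C)
  ...   | w , w∈Vi , yw =
    ∈Nb⁺ G (λ y∈Vi → proj₂ (avoids (isComp i) _ y∈Vi) (boundary⊆N[u] c y∉C v∈C vy)) w∈Vi (adj-sym yw)

  -- δ*_u lies entirely right of T_u, since it is not in D_u(V_i).
  Vj-right : ∀ w → w ∈ V j → R u ≪ R w
  Vj-right w w∈Vj with outside⇒onSide (avoids (isComp j) w w∈Vj)
  ... | inj₂ u≪w = u≪w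
  ... | inj₁ w≪u = ⊥-elim (proj₁ maximal
        (left-component-Nb⊆ (isComp j) (λ v → component-left (isComp j) w∈Vj w≪u)))

  -- A neighbour of u meeting a trapezoid right of T_u meets V_j: otherwise
  -- widening V_j would give a larger component of D*_u(V_i).
  right⇒meets-δ* : ∀ {x w} → Adj G u x → Adj G x w → R u ≪ R w → AdjToPred G (_∈ V j) x
  right⇒meets-δ* {x} ux xw u≪w = decidable-stable (meets? (V j) x) λ misses →
    let k , w∈Vk = indexOf (onSide⇒outside right u≪w)
        Vj⊂Vk = widen right (isComp j) (isComp k) Vj-right w∈Vk u≪w ux xw misses
        Vk∈D* : InDstar G V i k
        Vk∈D* Vk⊆Vi = proj₁ maximal (λ {y} → Vk⊆Vi ∘ proj₁ Vj⊂Vk {y})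
    in proj₂ maximal k Vk∈D* Vj⊂Vk

  δ⇔D₁ : ∀ {x} → Adj G u x → AdjToPred G (_∈ V i) x ⇔ AdjToPred G (D₁ R u) x
  δ⇔D₁ ux = mk⇔ (λ (w , w∈Vi , xw) → w , Vi-left w w∈Vi , xw)
                (λ (w , w≪u , xw) → left⇒meets-δ ux xw w≪u)

  δ*⇔D₂ : ∀ {x} → Adj G u x → AdjToPred G (_∈ V j) x ⇔ AdjToPred G (D₂ R u) x
  δ*⇔D₂ ux = mk⇔ (λ (w , w∈Vj , xw) → w , Vj-right w w∈Vj , xw)
                 (λ (w , u≪w , xw) → right⇒meets-δ* ux xw u≪w)

module _ {n} (G : Graph n) (u : Fin n) {A B A′ B′ : Fin n → Set} {x : Fin n}
         (A⇔A′ : Adj G u x → AdjToPred G A x ⇔ AdjToPred G A′ x)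
         (B⇔B′ : Adj G u x → AdjToPred G B x ⇔ AdjToPred G B′ x) where

  NX-transport : ∀ X → NX G X u A B x → NX G X u A′ B′ x
  NX-transport p0  (ux , ¬a , ¬b) = ux , ¬a ∘ from (A⇔A′ ux) , ¬b ∘ from (B⇔B′ ux)
  NX-transport p1  (ux , a  , ¬b) = ux , to (A⇔A′ ux) a      , ¬b ∘ from (B⇔B′ ux)
  NX-transport p2  (ux , ¬a , b)  = ux , ¬a ∘ from (A⇔A′ ux) , to (B⇔B′ ux) b
  NX-transport p12 (ux , a  , b)  = ux , to (A⇔A′ ux) a      , to (B⇔B′ ux) b

NX-cong : ∀ {n} (G : Graph n) (u : Fin n) {A B A′ B′ : Fin n → Set} {x : Fin n} →
          (Adj G u x → AdjToPred G A x ⇔ AdjToPred G A′ x) →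
          (Adj G u x → AdjToPred G B x ⇔ AdjToPred G B′ x) →
          ∀ X → NX G X u A B x ⇔ NX G X u A′ B′ x
NX-cong G u A⇔A′ B⇔B′ X = mk⇔
  (NX-transport G u A⇔A′ B⇔B′ X)
  (NX-transport G u (⇔.sym ∘ A⇔A′) (⇔.sym ∘ B⇔B′) X)

lemma2p10 : ∀ {n : ℕ} (G : Graph n) (R : Fin n → Trapezoid) → IsTrapezoidRep G R →
    (u : Fin n) (ω : ℕ) (V : Fin ω → Subset n) → Components G u ω V →
    (i j : Fin ω) → Master G V i → MaximalInDstar G V i j →
    (∀ x → x ∈ V i → R x ≪ R u) →
    ∀ (X : Part) (x : Fin n) →
      NX G X u (λ y → y ∈ V i) (λ y → y ∈ V j) x ⇔ NX G X u (D₁ R u) (D₂ R u) x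
lemma2p10 G R rep u ω V comps i j master maximal Vi-left X x =
  NX-cong G u δ⇔D₁ δ*⇔D₂ X
  where open Lemma-2-10 G R rep u ω V comps i j master maximal Vi-left
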